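{- No graph in $\mathcal{F}_3$ is a contact $B_0$-VPG graph.
   Context: A graph $G$ is contact $B_0$-VPG if there is a collection of nontrivial horizontal and vertical segments on a grid, pairwise interiorly disjoint, in one-to-one correspondence with $V(G)$, such that two vertices are adjacent iff their segments share a grid point that is an endpoint of at least one of them. $\mathcal{F}_3$ is the family of graphs obtained from an induced cycle $v_1\dots v_k$ with $k\ge5$ odd by attaching one new triangle to each $v_i$, where the vertices of each new triangle are pairwise adjacent, adjacent to $v_i$, and adjacent to nothing else. -}

module Defs where

open import Data.Nat using (ℕ; suc)
open import Data.Fin using (Fin; toℕ)
open import Data.Integer as ℤ using (ℤ)
open import Data.Rational as ℚ using (ℚ)
open import Data.Product using (Σ; _×_; _,_)
open import Data.Sum using (_⊎_)
open import Relation.Binary.PropositionalEquality using (_≡_; _≢_)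
open import Relation.Nullary using (¬_)
open import Function.Bundles using (_⇔_)

data Orientation : Set where
  hor ver : Orientation

-- A horizontal segment  {(x , fixed) : lo ≤ x ≤ hi}  or a vertical
-- segment  {(fixed , y) : lo ≤ y ≤ hi}, with integer coordinates and
-- lo < hi (nontrivial).
record Segment : Set where
  constructor seg
  field
    orient : Orientation
    fixed  : ℤ
    lo     : ℤ
    hi     : ℤ
    nontrivial : lo ℤ.< hi

open Segment public

GridPoint : Set
GridPoint = ℤ × ℤ

_∈Seg_ : GridPoint → Segment → Set
(x , y) ∈Seg (seg hor c l h _) = (y ≡ c) × (l ℤ.≤ x) × (x ℤ.≤ h)
(x , y) ∈Seg (seg ver c l h _) = (x ≡ c) × (l ℤ.≤ y) × (y ℤ.≤ h)

end₁ end₂ : Segment → GridPoint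
end₁ (seg hor c l h _) = (l , c)
end₁ (seg ver c l h _) = (c , l)
end₂ (seg hor c l h _) = (h , c)
end₂ (seg ver c l h _) = (c , h)

IsEndpoint : GridPoint → Segment → Set
IsEndpoint p s = (p ≡ end₁ s) ⊎ (p ≡ end₂ s)

ι : ℤ → ℚ
ι z = z ℚ./ 1

-- a point of the (real) plane, here taken rational, lies in the relative
-- interior of a segment (on the segment, not an endpoint)
InInterior : ℚ × ℚ → Segment → Set
InInterior (x , y) (seg hor c l h _) = (y ≡ ι c) × (ι l ℚ.< x) × (x ℚ.< ι h)
InInterior (x , y) (seg ver c l h _) = (x ≡ ι c) × (ι l ℚ.< y) × (y ℚ.< ι h)

InteriorlyDisjoint : Segment → Segment → Set
InteriorlyDisjoint s t = ∀ (p : ℚ × ℚ) → ¬ (InInterior p s × InInterior p t)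

Touch : Segment → Segment → Set
Touch s t = Σ GridPoint λ p → (p ∈Seg s) × (p ∈Seg t) × (IsEndpoint p s ⊎ IsEndpoint p t)

ContactB0VPG : (V : Set) → (V → V → Set) → Set
ContactB0VPG V E =
  Σ (V → Segment) λ σ →
    (∀ u v → u ≢ v → InteriorlyDisjoint (σ u) (σ v)) ×
    (∀ u v → u ≢ v → (E u v ⇔ Touch (σ u) (σ v)))

-- The family 𝓕₃: cycle v₀ … v_{k-1} with a triangle attached at each vᵢ

CycleAdj : {k : ℕ} → Fin k → Fin k → Set
CycleAdj {k} i j =
  (suc (toℕ i) ≡ toℕ j) ⊎ (suc (toℕ j) ≡ toℕ i) ⊎
  ((toℕ i ≡ 0) × (suc (toℕ j) ≡ k)) ⊎ ((toℕ j ≡ 0) × (suc (toℕ i) ≡ k))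

data F3Vertex (k : ℕ) : Set where
  cyc : Fin k → F3Vertex k
  tri : Fin k → Fin 3 → F3Vertex k

F3Adj : (k : ℕ) → F3Vertex k → F3Vertex k → Set
F3Adj k (cyc i)   (cyc j)   = CycleAdj i j
F3Adj k (cyc i)   (tri j b) = i ≡ j
F3Adj k (tri i a) (cyc j)   = i ≡ j
F3Adj k (tri i a) (tri j b) = (i ≡ j) × (a ≢ b)

-- The triangle at a cycle vertex v forms a K₄ together with v, and three pairwise touching
-- segments cannot all touch a segment S away from its endpoints (they would be perpendicular
-- to S, and two of them would overlap). So one endpoint of the segment Sᵥ lies on its triangle,
-- and only the other, free end of Sᵥ can meet other cycle segments: consecutive cycle segments
-- meet at the free end of one of them. If the free end of Sᵢ₊₁ lies on Sᵢ it cannot also lie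
-- on Sᵢ₊₂, so Sᵢ₊₁ and Sᵢ₊₂ meet at the free end of Sᵢ₊₂, and this propagates round the cycle.
-- Parallel neighbours would meet at the free ends of both, which contradicts the propagated
-- pattern; so consecutive segments are perpendicular, which is impossible on an odd cycle.
module Submission where

open import Defs
open import Data.Nat using (ℕ; suc; _*_; _≤_)
open import Data.Product using (∃)
open import Relation.Binary.PropositionalEquality using (_≡_)
open import Relation.Nullary using (¬_)

open import Data.Nat using (zero; _+_; s≤s; z≤n)
import Data.Nat.Properties as ℕP
open import Data.Nat.DivMod using (_%_; _mod_; %-distribˡ-+; m<n⇒m%n≡m; n%n≡0; m%n<n; [m+n]%n≡m%n)
open import Data.Nat.Coprimality using (1-coprimeTo) renaming (sym to coprime-sym)
open import Data.Fin using (Fin; toℕ; #_)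
import Data.Fin.Properties as FinP
open import Data.Integer as ℤ using (ℤ; +_; -[1+_])
import Data.Integer.Properties as ℤP
open import Data.Rational as ℚ using (ℚ; mkℚ)
import Data.Rational.Properties as ℚP
open import Data.Product using (_×_; _,_; proj₁; proj₂; swap)
import Data.Product as Product
open import Data.Product.Properties using (≡-dec)
open import Data.Sum using (_⊎_; inj₁; inj₂)
import Data.Sum as Sum
open import Data.Empty using (⊥; ⊥-elim)
open import Function using (_∘_)
open import Function.Bundles using (_⇔_; Equivalence)
open import Relation.Binary.PropositionalEquality
  using (_≢_; refl; sym; trans; cong; cong₂; subst; subst₂; ≢-sym)
open import Relation.Nullary using (Dec; yes; no)
open import Relation.Nullary.Decidable using (_⊎-dec_; _×-dec_)

ι≡mkℚ : ∀ z → ι z ≡ mkℚ z 0 (coprime-sym (1-coprimeTo ℤ.∣ z ∣))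
ι≡mkℚ (+ n)    = ℚP.normalize-coprime (coprime-sym (1-coprimeTo n))
ι≡mkℚ -[1+ n ] = cong ℚ.-_ (ℚP.normalize-coprime (coprime-sym (1-coprimeTo (suc n))))

ι-mono-< : ∀ {a b} → a ℤ.< b → ι a ℚ.< ι b
ι-mono-< {a} {b} a<b rewrite ι≡mkℚ a | ι≡mkℚ b =
  ℚ.*<* (subst₂ ℤ._<_ (sym (ℤP.*-identityʳ a)) (sym (ℤP.*-identityʳ b)) a<b)

ι-mono-≤ : ∀ {a b} → a ℤ.≤ b → ι a ℚ.≤ ι b
ι-mono-≤ {a} {b} a≤b rewrite ι≡mkℚ a | ι≡mkℚ b =
  ℚ.*≤* (subst₂ ℤ._≤_ (sym (ℤP.*-identityʳ a)) (sym (ℤP.*-identityʳ b)) a≤b)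

ιᵖ : GridPoint → ℚ × ℚ
ιᵖ (x , y) = ι x , ι y

_≟ᵖ_ : (p q : GridPoint) → Dec (p ≡ q)
_≟ᵖ_ = ≡-dec ℤ._≟_ ℤ._≟_

IsEndpoint? : ∀ p s → Dec (IsEndpoint p s)
IsEndpoint? p s = (p ≟ᵖ end₁ s) ⊎-dec (p ≟ᵖ end₂ s)

_∈Seg?_ : ∀ p s → Dec (p ∈Seg s)
(x , y) ∈Seg? seg hor c l h _ = (y ℤ.≟ c) ×-dec ((l ℤ.≤? x) ×-dec (x ℤ.≤? h))
(x , y) ∈Seg? seg ver c l h _ = (x ℤ.≟ c) ×-dec ((l ℤ.≤? y) ×-dec (y ℤ.≤? h))

InteriorlyDisjoint-sym : ∀ {s t} → InteriorlyDisjoint s t → InteriorlyDisjoint t s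
InteriorlyDisjoint-sym disjoint p (p∈t , p∈s) = disjoint p (p∈s , p∈t)

Contact : Segment → Segment → Set
Contact s t = InteriorlyDisjoint s t × Touch s t

flip : Orientation → Orientation
flip hor = ver
flip ver = hor

transpose : Segment → Segment
transpose (seg o c l h l<h) = seg (flip o) c l h l<h

∈Seg-transpose : ∀ {p} s → p ∈Seg s → swap p ∈Seg transpose s
∈Seg-transpose (seg hor _ _ _ _) p∈s = p∈s
∈Seg-transpose (seg ver _ _ _ _) p∈s = p∈s

∈Seg-transpose⁻ : ∀ {p} s → swap p ∈Seg transpose s → p ∈Seg s
∈Seg-transpose⁻ (seg hor _ _ _ _) p∈s = p∈s
∈Seg-transpose⁻ (seg ver _ _ _ _) p∈s = p∈s

IsEndpoint-transpose : ∀ {p} s → IsEndpoint p s → IsEndpoint (swap p) (transpose s)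
IsEndpoint-transpose (seg hor _ _ _ _) = Sum.map (cong swap) (cong swap)
IsEndpoint-transpose (seg ver _ _ _ _) = Sum.map (cong swap) (cong swap)

IsEndpoint-transpose⁻ : ∀ {p} s → IsEndpoint p (transpose s) → IsEndpoint (swap p) s
IsEndpoint-transpose⁻ (seg hor _ _ _ _) = Sum.map (cong swap) (cong swap)
IsEndpoint-transpose⁻ (seg ver _ _ _ _) = Sum.map (cong swap) (cong swap)

InInterior-transpose⁻ : ∀ {q} s → InInterior q (transpose s) → InInterior (swap q) s
InInterior-transpose⁻ (seg hor _ _ _ _) q∈s = q∈s
InInterior-transpose⁻ (seg ver _ _ _ _) q∈s = q∈s

InteriorlyDisjoint-transpose : ∀ s t → InteriorlyDisjoint s t → InteriorlyDisjoint (transpose s) (transpose t)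
InteriorlyDisjoint-transpose s t disjoint q (q∈s , q∈t) =
  disjoint (swap q) (InInterior-transpose⁻ s q∈s , InInterior-transpose⁻ t q∈t)

Touch-transpose : ∀ s t → Touch s t → Touch (transpose s) (transpose t)
Touch-transpose s t (p , p∈s , p∈t , end) =
  swap p , ∈Seg-transpose s p∈s , ∈Seg-transpose t p∈t ,
  Sum.map (IsEndpoint-transpose s) (IsEndpoint-transpose t) end

Contact-transpose : ∀ s t → Contact s t → Contact (transpose s) (transpose t)
Contact-transpose s t = Product.map (InteriorlyDisjoint-transpose s t) (Touch-transpose s t)

off-endpointsʰ : ∀ {x y c l h} (l<h : l ℤ.< h) → (x , y) ∈Seg seg hor c l h l<h →
                 ¬ IsEndpoint (x , y) (seg hor c l h l<h) → l ℤ.< x × x ℤ.< h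
off-endpointsʰ _ (y≡c , l≤x , x≤h) ¬end =
  ℤP.≤∧≢⇒< l≤x (λ l≡x → ¬end (inj₁ (cong₂ _,_ (sym l≡x) y≡c))) ,
  ℤP.≤∧≢⇒< x≤h (λ x≡h → ¬end (inj₂ (cong₂ _,_ x≡h y≡c)))

interior-point : ∀ {p} s → p ∈Seg s → ¬ IsEndpoint p s → InInterior (ιᵖ p) s
interior-point (seg hor c l h l<h) p∈s ¬end =
  let l<x , x<h = off-endpointsʰ l<h p∈s ¬end in cong ι (proj₁ p∈s) , ι-mono-< l<x , ι-mono-< x<h
interior-point (seg ver c l h l<h) p∈s ¬end =
  interior-point (seg hor c l h l<h) p∈s (¬end ∘ IsEndpoint-transpose (seg hor c l h l<h))

common-point⇒endpoint : ∀ {p} s t → InteriorlyDisjoint s t → p ∈Seg s → p ∈Seg t →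
                        IsEndpoint p s ⊎ IsEndpoint p t
common-point⇒endpoint {p} s t disjoint p∈s p∈t with IsEndpoint? p s | IsEndpoint? p t
... | yes end | _       = inj₁ end
... | no _    | yes end = inj₂ end
... | no ¬e   | no ¬e′  = ⊥-elim (disjoint (ιᵖ p) (interior-point s p∈s ¬e , interior-point t p∈t ¬e′))

common-point⇒Touch : ∀ {p} s t → InteriorlyDisjoint s t → p ∈Seg s → p ∈Seg t → Touch s t
common-point⇒Touch {p} s t disjoint p∈s p∈t = p , p∈s , p∈t , common-point⇒endpoint s t disjoint p∈s p∈t

-- The common part (a, b) may contain no grid point, hence the rational witness.
common-subinterval⇒¬disjoint : ∀ c {l₁ h₁ l₂ h₂ a b} (l₁<h₁ : l₁ ℤ.< h₁) (l₂<h₂ : l₂ ℤ.< h₂) →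
  l₁ ℤ.≤ a → l₂ ℤ.≤ a → b ℤ.≤ h₁ → b ℤ.≤ h₂ → a ℤ.< b →
  ¬ InteriorlyDisjoint (seg hor c l₁ h₁ l₁<h₁) (seg hor c l₂ h₂ l₂<h₂)
common-subinterval⇒¬disjoint c {a = a} {b} _ _ l₁≤a l₂≤a b≤h₁ b≤h₂ a<b disjoint
  with ℚP.<-dense (ι-mono-< a<b)
... | q , a<q , q<b = disjoint (q , ι c) (inside l₁≤a b≤h₁ , inside l₂≤a b≤h₂)
  where
  inside : ∀ {l h} → l ℤ.≤ a → b ℤ.≤ h → (ι c ≡ ι c) × (ι l ℚ.< q) × (q ℚ.< ι h)
  inside l≤a b≤h = refl , ℚP.≤-<-trans (ι-mono-≤ l≤a) a<q , ℚP.<-≤-trans q<b (ι-mono-≤ b≤h)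

overlapping-horizontals⇒¬disjoint : ∀ {c c′ l₁ h₁ l₂ h₂} (l₁<h₁ : l₁ ℤ.< h₁) (l₂<h₂ : l₂ ℤ.< h₂) →
  c ≡ c′ → l₁ ℤ.< h₂ → l₂ ℤ.< h₁ →
  ¬ InteriorlyDisjoint (seg hor c l₁ h₁ l₁<h₁) (seg hor c′ l₂ h₂ l₂<h₂)
overlapping-horizontals⇒¬disjoint {c} {l₁ = l₁} {h₁} {l₂} {h₂} l₁<h₁ l₂<h₂ refl l₁<h₂ l₂<h₁
  with ℤP.≤-total l₁ l₂ | ℤP.≤-total h₁ h₂
... | inj₁ l₁≤l₂ | inj₁ h₁≤h₂ =
  common-subinterval⇒¬disjoint c l₁<h₁ l₂<h₂ l₁≤l₂ ℤP.≤-refl ℤP.≤-refl h₁≤h₂ l₂<h₁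
... | inj₁ l₁≤l₂ | inj₂ h₂≤h₁ =
  common-subinterval⇒¬disjoint c l₁<h₁ l₂<h₂ l₁≤l₂ ℤP.≤-refl h₂≤h₁ ℤP.≤-refl l₂<h₂
... | inj₂ l₂≤l₁ | inj₁ h₁≤h₂ =
  common-subinterval⇒¬disjoint c l₁<h₁ l₂<h₂ ℤP.≤-refl l₂≤l₁ ℤP.≤-refl h₁≤h₂ l₁<h₁
... | inj₂ l₂≤l₁ | inj₂ h₂≤h₁ =
  common-subinterval⇒¬disjoint c l₁<h₁ l₂<h₂ ℤP.≤-refl l₂≤l₁ h₂≤h₁ ℤP.≤-refl l₁<h₂


overlapping-verticals⇒¬disjoint : ∀ {c c′ l₁ h₁ l₂ h₂} (l₁<h₁ : l₁ ℤ.< h₁) (l₂<h₂ : l₂ ℤ.< h₂) →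
  c ≡ c′ → l₁ ℤ.< h₂ → l₂ ℤ.< h₁ →
  ¬ InteriorlyDisjoint (seg ver c l₁ h₁ l₁<h₁) (seg ver c′ l₂ h₂ l₂<h₂)
overlapping-verticals⇒¬disjoint {c} {c′} {l₁} {h₁} {l₂} {h₂} l₁<h₁ l₂<h₂ c≡c′ l₁<h₂ l₂<h₁ =
  overlapping-horizontals⇒¬disjoint l₁<h₁ l₂<h₂ c≡c′ l₁<h₂ l₂<h₁ ∘
  InteriorlyDisjoint-transpose (seg ver c l₁ h₁ l₁<h₁) (seg ver c′ l₂ h₂ l₂<h₂)

endpoint-transferʰ : ∀ {x y c₁ l₁ h₁ c₂ l₂ h₂} (l₁<h₁ : l₁ ℤ.< h₁) (l₂<h₂ : l₂ ℤ.< h₂) →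
  InteriorlyDisjoint (seg hor c₁ l₁ h₁ l₁<h₁) (seg hor c₂ l₂ h₂ l₂<h₂) →
  (x , y) ∈Seg seg hor c₁ l₁ h₁ l₁<h₁ → (x , y) ∈Seg seg hor c₂ l₂ h₂ l₂<h₂ →
  IsEndpoint (x , y) (seg hor c₁ l₁ h₁ l₁<h₁) → IsEndpoint (x , y) (seg hor c₂ l₂ h₂ l₂<h₂)
endpoint-transferʰ {x} {y} {c₁} {l₁} {h₁} {c₂} {l₂} {h₂} l₁<h₁ l₂<h₂ disjoint p∈s p∈t end
  with IsEndpoint? (x , y) (seg hor c₂ l₂ h₂ l₂<h₂)
... | yes end′ = end′
... | no ¬end′ = ⊥-elim (collinear-overlap (Sum.map (cong proj₁) (cong proj₁) end))
  where
  same-row : c₁ ≡ c₂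
  same-row = trans (sym (proj₁ p∈s)) (proj₁ p∈t)
  l₂<x : l₂ ℤ.< x
  l₂<x = proj₁ (off-endpointsʰ l₂<h₂ p∈t ¬end′)
  x<h₂ : x ℤ.< h₂
  x<h₂ = proj₂ (off-endpointsʰ l₂<h₂ p∈t ¬end′)
  collinear-overlap : (x ≡ l₁) ⊎ (x ≡ h₁) → ⊥
  collinear-overlap (inj₁ refl) =
    overlapping-horizontals⇒¬disjoint l₁<h₁ l₂<h₂ same-row x<h₂ (ℤP.<-trans l₂<x l₁<h₁) disjoint
  collinear-overlap (inj₂ refl) =
    overlapping-horizontals⇒¬disjoint l₁<h₁ l₂<h₂ same-row (ℤP.<-trans l₁<h₁ x<h₂) l₂<x disjoint

parallel-contact⇒endpoints : ∀ {p} s t → orient s ≡ orient t → InteriorlyDisjoint s t →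
                             p ∈Seg s → p ∈Seg t → IsEndpoint p s × IsEndpoint p t
parallel-contact⇒endpoints s@(seg hor _ _ _ l<h) t@(seg hor _ _ _ l′<h′) _ disjoint p∈s p∈t
  with common-point⇒endpoint s t disjoint p∈s p∈t
... | inj₁ end = end , endpoint-transferʰ l<h l′<h′ disjoint p∈s p∈t end
... | inj₂ end = endpoint-transferʰ l′<h′ l<h (InteriorlyDisjoint-sym {s} {t} disjoint) p∈t p∈s end , end
parallel-contact⇒endpoints (seg hor _ _ _ _) (seg ver _ _ _ _) () _ _ _
parallel-contact⇒endpoints (seg ver _ _ _ _) (seg hor _ _ _ _) () _ _ _
parallel-contact⇒endpoints s@(seg ver c l h l<h) t@(seg ver c′ l′ h′ l′<h′) _ disjoint p∈s p∈t =
  Product.map (IsEndpoint-transpose⁻ s) (IsEndpoint-transpose⁻ t)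
    (parallel-contact⇒endpoints (seg hor c l h l<h) (seg hor c′ l′ h′ l′<h′) refl
      (InteriorlyDisjoint-transpose s t disjoint) (∈Seg-transpose s p∈s) (∈Seg-transpose t p∈t))

NoEndpointOn : Segment → Segment → Set
NoEndpointOn s t = ∀ p → IsEndpoint p s → ¬ p ∈Seg t

NoEndpointOn-transpose : ∀ s t → NoEndpointOn s t → NoEndpointOn (transpose s) (transpose t)
NoEndpointOn-transpose s t avoid p end p∈t =
  avoid (swap p) (IsEndpoint-transpose⁻ s end) (∈Seg-transpose⁻ t p∈t)

data EndsOnRow (c : ℤ) : Segment → Set where
  lower-end : ∀ {x h} {c<h : c ℤ.< h} → EndsOnRow c (seg ver x c h c<h)
  upper-end : ∀ {x l} {l<c : l ℤ.< c} → EndsOnRow c (seg ver x l c l<c)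

contact-avoiding-endpoints⇒EndsOnRow : ∀ {c l h} (l<h : l ℤ.< h) T →
  Contact (seg hor c l h l<h) T → NoEndpointOn (seg hor c l h l<h) T → EndsOnRow c T
contact-avoiding-endpoints⇒EndsOnRow _ T (_ , p , _ , p∈T , inj₁ end) avoid = ⊥-elim (avoid p end p∈T)
contact-avoiding-endpoints⇒EndsOnRow {c} {l} {h} l<h T@(seg hor _ _ _ _)
  (disjoint , p , p∈S , p∈T , inj₂ _) avoid =
  ⊥-elim (avoid p (proj₁ (parallel-contact⇒endpoints (seg hor c l h l<h) T refl disjoint p∈S p∈T)) p∈T)
contact-avoiding-endpoints⇒EndsOnRow _ (seg ver _ _ _ _) (_ , _ , (y≡c , _) , _ , inj₂ (inj₁ refl)) _
  with y≡c
... | refl = lower-end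
contact-avoiding-endpoints⇒EndsOnRow _ (seg ver _ _ _ _) (_ , _ , (y≡c , _) , _ , inj₂ (inj₂ refl)) _
  with y≡c
... | refl = upper-end

common-lower-end⇒¬Contact : ∀ {c x₁ h₁ x₂ h₂} (c<h₁ : c ℤ.< h₁) (c<h₂ : c ℤ.< h₂) →
  ¬ Contact (seg ver x₁ c h₁ c<h₁) (seg ver x₂ c h₂ c<h₂)
common-lower-end⇒¬Contact c<h₁ c<h₂ (disjoint , _ , (x≡x₁ , _) , (x≡x₂ , _) , _) =
  overlapping-verticals⇒¬disjoint c<h₁ c<h₂ (trans (sym x≡x₁) x≡x₂) c<h₂ c<h₁ disjoint

common-upper-end⇒¬Contact : ∀ {c x₁ l₁ x₂ l₂} (l₁<c : l₁ ℤ.< c) (l₂<c : l₂ ℤ.< c) →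
  ¬ Contact (seg ver x₁ l₁ c l₁<c) (seg ver x₂ l₂ c l₂<c)
common-upper-end⇒¬Contact l₁<c l₂<c (disjoint , _ , (x≡x₁ , _) , (x≡x₂ , _) , _) =
  overlapping-verticals⇒¬disjoint l₁<c l₂<c (trans (sym x≡x₁) x≡x₂) l₁<c l₂<c disjoint

three-ends-on-row-clash : ∀ {c T₀ T₁ T₂} → EndsOnRow c T₀ → EndsOnRow c T₁ → EndsOnRow c T₂ →
                          Contact T₀ T₁ → Contact T₀ T₂ → Contact T₁ T₂ → ⊥
three-ends-on-row-clash (lower-end {c<h = a}) (lower-end {c<h = b}) _ c₀₁ _ _ =
  common-lower-end⇒¬Contact a b c₀₁
three-ends-on-row-clash (upper-end {l<c = a}) (upper-end {l<c = b}) _ c₀₁ _ _ =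
  common-upper-end⇒¬Contact a b c₀₁
three-ends-on-row-clash (lower-end {c<h = a}) upper-end (lower-end {c<h = b}) _ c₀₂ _ =
  common-lower-end⇒¬Contact a b c₀₂
three-ends-on-row-clash (upper-end {l<c = a}) lower-end (upper-end {l<c = b}) _ c₀₂ _ =
  common-upper-end⇒¬Contact a b c₀₂
three-ends-on-row-clash lower-end (upper-end {l<c = a}) (upper-end {l<c = b}) _ _ c₁₂ =
  common-upper-end⇒¬Contact a b c₁₂
three-ends-on-row-clash upper-end (lower-end {c<h = a}) (lower-end {c<h = b}) _ _ c₁₂ =
  common-lower-end⇒¬Contact a b c₁₂

¬K₄-avoiding-endpointsʰ : ∀ {c l h} (l<h : l ℤ.< h) {T₀ T₁ T₂} → let S = seg hor c l h l<h in
  Contact S T₀ → Contact S T₁ → Contact S T₂ → Contact T₀ T₁ → Contact T₀ T₂ → Contact T₁ T₂ →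
  NoEndpointOn S T₀ → NoEndpointOn S T₁ → NoEndpointOn S T₂ → ⊥
¬K₄-avoiding-endpointsʰ l<h {T₀} {T₁} {T₂} c₀ c₁ c₂ c₀₁ c₀₂ c₁₂ a₀ a₁ a₂ =
  three-ends-on-row-clash
    (contact-avoiding-endpoints⇒EndsOnRow l<h T₀ c₀ a₀)
    (contact-avoiding-endpoints⇒EndsOnRow l<h T₁ c₁ a₁)
    (contact-avoiding-endpoints⇒EndsOnRow l<h T₂ c₂ a₂)
    c₀₁ c₀₂ c₁₂

¬K₄-avoiding-endpoints : ∀ S {T₀ T₁ T₂} →
  Contact S T₀ → Contact S T₁ → Contact S T₂ → Contact T₀ T₁ → Contact T₀ T₂ → Contact T₁ T₂ →
  NoEndpointOn S T₀ → NoEndpointOn S T₁ → NoEndpointOn S T₂ → ⊥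
¬K₄-avoiding-endpoints (seg hor _ _ _ l<h) = ¬K₄-avoiding-endpointsʰ l<h
¬K₄-avoiding-endpoints S@(seg ver _ _ _ l<h) {T₀} {T₁} {T₂} c₀ c₁ c₂ c₀₁ c₀₂ c₁₂ a₀ a₁ a₂ =
  ¬K₄-avoiding-endpointsʰ l<h
    (Contact-transpose S T₀ c₀) (Contact-transpose S T₁ c₁) (Contact-transpose S T₂ c₂)
    (Contact-transpose T₀ T₁ c₀₁) (Contact-transpose T₀ T₂ c₀₂) (Contact-transpose T₁ T₂ c₁₂)
    (NoEndpointOn-transpose S T₀ a₀) (NoEndpointOn-transpose S T₁ a₁) (NoEndpointOn-transpose S T₂ a₂)

two-orientations : ∀ {a b c : Orientation} → a ≢ b → b ≢ c → a ≡ c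
two-orientations {hor} {hor}       a≢b _   = ⊥-elim (a≢b refl)
two-orientations {ver} {ver}       a≢b _   = ⊥-elim (a≢b refl)
two-orientations {_}   {hor} {hor} _   b≢c = ⊥-elim (b≢c refl)
two-orientations {_}   {ver} {ver} _   b≢c = ⊥-elim (b≢c refl)
two-orientations {hor} {ver} {hor} _   _   = refl
two-orientations {ver} {hor} {ver} _   _   = refl

-- k ≥ 4 is what makes positions i and i + 2 distinct and non-adjacent on the cycle.
module CycleIndex (r : ℕ) where

  k : ℕ
  k = 4 + r

  CycleAdjℕ : ℕ → ℕ → Set
  CycleAdjℕ a b = (suc a ≡ b) ⊎ (suc b ≡ a) ⊎ ((a ≡ 0) × (suc b ≡ k)) ⊎ ((b ≡ 0) × (suc a ≡ k))

  Next : ℕ → ℕ → Set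
  Next a b = (b ≡ suc a) ⊎ ((b ≡ 0) × (suc a ≡ k))

  Next-% : ∀ i → Next (i % k) (suc i % k)
  Next-% i with ℕP.m≤n⇒m<n∨m≡n (m%n<n i k)
  ... | inj₁ 1+i%k<k = inj₁ (trans (%-distribˡ-+ 1 i k) (m<n⇒m%n≡m 1+i%k<k))
  ... | inj₂ 1+i%k≡k = inj₂ (trans (%-distribˡ-+ 1 i k) (trans (cong (_% k) 1+i%k≡k) (n%n≡0 k)) , 1+i%k≡k)

  Next⇒CycleAdjℕ : ∀ {a b} → Next a b → CycleAdjℕ a b
  Next⇒CycleAdjℕ (inj₁ refl)         = inj₁ refl
  Next⇒CycleAdjℕ (inj₂ (refl , 1+a≡k)) = inj₂ (inj₂ (inj₂ (refl , 1+a≡k)))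

  Next⇒≢ : ∀ {a b} → Next a b → a ≢ b
  Next⇒≢ (inj₁ refl) ()
  Next⇒≢ (inj₂ (refl , ())) refl

  Next²⇒≢ : ∀ {a b c} → Next a b → Next b c → a ≢ c
  Next²⇒≢ (inj₁ refl) (inj₁ refl) ()
  Next²⇒≢ (inj₁ refl) (inj₂ (refl , ())) refl
  Next²⇒≢ (inj₂ (refl , ())) (inj₁ refl) refl
  Next²⇒≢ (inj₂ (refl , _)) (inj₂ (_ , ()))

  Next²⇒¬CycleAdjℕ : ∀ {a b c} → Next a b → Next b c → ¬ CycleAdjℕ a c
  Next²⇒¬CycleAdjℕ (inj₁ refl) (inj₁ refl) (inj₁ ())
  Next²⇒¬CycleAdjℕ (inj₁ refl) (inj₁ refl) (inj₂ (inj₁ ()))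
  Next²⇒¬CycleAdjℕ (inj₁ refl) (inj₁ refl) (inj₂ (inj₂ (inj₁ (refl , ()))))
  Next²⇒¬CycleAdjℕ (inj₁ refl) (inj₁ refl) (inj₂ (inj₂ (inj₂ (() , _))))
  Next²⇒¬CycleAdjℕ (inj₁ refl) (inj₂ (refl , refl)) (inj₁ ())
  Next²⇒¬CycleAdjℕ (inj₁ refl) (inj₂ (refl , refl)) (inj₂ (inj₁ ()))
  Next²⇒¬CycleAdjℕ (inj₁ refl) (inj₂ (refl , refl)) (inj₂ (inj₂ (inj₁ (() , _))))
  Next²⇒¬CycleAdjℕ (inj₁ refl) (inj₂ (refl , refl)) (inj₂ (inj₂ (inj₂ (_ , ()))))
  Next²⇒¬CycleAdjℕ (inj₂ (refl , refl)) (inj₁ refl) (inj₁ ())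
  Next²⇒¬CycleAdjℕ (inj₂ (refl , refl)) (inj₁ refl) (inj₂ (inj₁ ()))
  Next²⇒¬CycleAdjℕ (inj₂ (refl , refl)) (inj₁ refl) (inj₂ (inj₂ (inj₁ (() , _))))
  Next²⇒¬CycleAdjℕ (inj₂ (refl , refl)) (inj₁ refl) (inj₂ (inj₂ (inj₂ (() , _))))
  Next²⇒¬CycleAdjℕ (inj₂ (refl , _)) (inj₂ (_ , ()))

  at : ℕ → Fin k
  at i = i mod k

  toℕ-at : ∀ i → toℕ (at i) ≡ i % k
  toℕ-at i = FinP.toℕ-fromℕ< (m%n<n i k)

  %-≢⇒at-≢ : ∀ i j → i % k ≢ j % k → at i ≢ at j
  %-≢⇒at-≢ i j i≢j at-i≡at-j = i≢j (trans (sym (toℕ-at i)) (trans (cong toℕ at-i≡at-j) (toℕ-at j)))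

  at-periodic : ∀ j → at (k + j) ≡ at j
  at-periodic j = FinP.fromℕ<-cong _ _ (trans (cong (_% k) (ℕP.+-comm k j)) ([m+n]%n≡m%n j k)) _ _

  at-suc-adjacent : ∀ i → CycleAdj (at i) (at (suc i))
  at-suc-adjacent i = subst₂ CycleAdjℕ (sym (toℕ-at i)) (sym (toℕ-at (suc i))) (Next⇒CycleAdjℕ (Next-% i))

  at-suc-≢ : ∀ i → at i ≢ at (suc i)
  at-suc-≢ i = %-≢⇒at-≢ i (suc i) (Next⇒≢ (Next-% i))

  at-2+-¬adjacent : ∀ i → ¬ CycleAdj (at i) (at (2 + i))
  at-2+-¬adjacent i adjacent =
    Next²⇒¬CycleAdjℕ (Next-% i) (Next-% (suc i)) (subst₂ CycleAdjℕ (toℕ-at i) (toℕ-at (2 + i)) adjacent)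

  at-2+-≢ : ∀ i → at i ≢ at (2 + i)
  at-2+-≢ i = %-≢⇒at-≢ i (2 + i) (Next²⇒≢ (Next-% i) (Next-% (suc i)))

module Representation (r : ℕ) (σ : F3Vertex (4 + r) → Segment)
  (disjoint : ∀ u v → u ≢ v → InteriorlyDisjoint (σ u) (σ v))
  (adjacency : ∀ u v → u ≢ v → F3Adj (4 + r) u v ⇔ Touch (σ u) (σ v)) where

  open CycleIndex r

  contact : ∀ u v → u ≢ v → F3Adj k u v → Contact (σ u) (σ v)
  contact u v u≢v uv = disjoint u v u≢v , Equivalence.to (adjacency u v u≢v) uv

  common-point⇒adjacent : ∀ {p} u v → u ≢ v → p ∈Seg σ u → p ∈Seg σ v → F3Adj k u v
  common-point⇒adjacent u v u≢v p∈u p∈v =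
    Equivalence.from (adjacency u v u≢v) (common-point⇒Touch (σ u) (σ v) (disjoint u v u≢v) p∈u p∈v)

  OnTriangle : GridPoint → Fin k → Set
  OnTriangle p x = ∃ λ a → p ∈Seg σ (tri x a)

  OnTriangle? : ∀ p x → Dec (OnTriangle p x)
  OnTriangle? p x = FinP.any? (λ a → p ∈Seg? σ (tri x a))

  triangle-meets-endpoint : ∀ x → OnTriangle (end₁ (σ (cyc x))) x ⊎ OnTriangle (end₂ (σ (cyc x))) x
  triangle-meets-endpoint x with OnTriangle? (end₁ (σ (cyc x))) x | OnTriangle? (end₂ (σ (cyc x))) x
  ... | yes on | _       = inj₁ on
  ... | no _   | yes on  = inj₂ on
  ... | no ¬on | no ¬on′ =
    ⊥-elim (¬K₄-avoiding-endpoints (σ (cyc x))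
      (cycle-to-triangle (# 0)) (cycle-to-triangle (# 1)) (cycle-to-triangle (# 2))
      (contact (tri x (# 0)) (tri x (# 1)) (λ ()) (refl , λ ()))
      (contact (tri x (# 0)) (tri x (# 2)) (λ ()) (refl , λ ()))
      (contact (tri x (# 1)) (tri x (# 2)) (λ ()) (refl , λ ()))
      (avoids (# 0)) (avoids (# 1)) (avoids (# 2)))
    where
    cycle-to-triangle : ∀ a → Contact (σ (cyc x)) (σ (tri x a))
    cycle-to-triangle a = contact (cyc x) (tri x a) (λ ()) refl
    avoids : ∀ a → NoEndpointOn (σ (cyc x)) (σ (tri x a))
    avoids a _ (inj₁ refl) p∈T = ¬on (a , p∈T)
    avoids a _ (inj₂ refl) p∈T = ¬on′ (a , p∈T)

  triangle-avoids-other-cycle-segments : ∀ {p x y} → y ≢ x → OnTriangle p x → ¬ p ∈Seg σ (cyc y)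
  triangle-avoids-other-cycle-segments {x = x} {y} y≢x (a , p∈T) p∈S =
    y≢x (common-point⇒adjacent (cyc y) (tri x a) (λ ()) p∈S p∈T)

  free-end : Fin k → GridPoint
  free-end x with triangle-meets-endpoint x
  ... | inj₁ _ = end₂ (σ (cyc x))
  ... | inj₂ _ = end₁ (σ (cyc x))

  free-end-unique : ∀ {p x y} → y ≢ x → IsEndpoint p (σ (cyc x)) → p ∈Seg σ (cyc y) → p ≡ free-end x
  free-end-unique {x = x} y≢x end p∈S with triangle-meets-endpoint x
  free-end-unique y≢x (inj₁ refl) p∈S | inj₁ on = ⊥-elim (triangle-avoids-other-cycle-segments y≢x on p∈S)
  free-end-unique y≢x (inj₂ refl) p∈S | inj₁ _  = refl
  free-end-unique y≢x (inj₁ refl) p∈S | inj₂ _  = refl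
  free-end-unique y≢x (inj₂ refl) p∈S | inj₂ on = ⊥-elim (triangle-avoids-other-cycle-segments y≢x on p∈S)

  S : ℕ → Segment
  S i = σ (cyc (at i))

  free : ℕ → GridPoint
  free i = free-end (at i)

  cyc-≢ : ∀ {x y : Fin k} → x ≢ y → cyc x ≢ cyc y
  cyc-≢ x≢y refl = x≢y refl

  consecutive-contact : ∀ i → Contact (S i) (S (suc i))
  consecutive-contact i = contact (cyc (at i)) (cyc (at (suc i))) (cyc-≢ (at-suc-≢ i)) (at-suc-adjacent i)

  two-apart-share-no-point : ∀ {p} i → p ∈Seg S i → p ∈Seg S (2 + i) → ⊥
  two-apart-share-no-point i p∈Sᵢ p∈Sᵢ₊₂ =
    at-2+-¬adjacent i (common-point⇒adjacent (cyc (at i)) (cyc (at (2 + i))) (cyc-≢ (at-2+-≢ i)) p∈Sᵢ p∈Sᵢ₊₂)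

  FreeEndOnNext FreeEndOnPrevious : ℕ → Set
  FreeEndOnNext i = free i ∈Seg S (suc i)
  FreeEndOnPrevious i = free (suc i) ∈Seg S i

  consecutive-meet-at-free-end : ∀ i → FreeEndOnNext i ⊎ FreeEndOnPrevious i
  consecutive-meet-at-free-end i with proj₂ (consecutive-contact i)
  ... | _ , p∈Sᵢ , p∈Sᵢ₊₁ , inj₁ end =
    inj₁ (subst (_∈Seg S (suc i)) (free-end-unique (≢-sym (at-suc-≢ i)) end p∈Sᵢ₊₁) p∈Sᵢ₊₁)
  ... | _ , p∈Sᵢ , p∈Sᵢ₊₁ , inj₂ end =
    inj₂ (subst (_∈Seg S i) (free-end-unique (at-suc-≢ i) end p∈Sᵢ) p∈Sᵢ)

  FreeEndOnPrevious-suc : ∀ i → FreeEndOnPrevious i → FreeEndOnPrevious (suc i)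
  FreeEndOnPrevious-suc i previous with consecutive-meet-at-free-end (suc i)
  ... | inj₁ next      = ⊥-elim (two-apart-share-no-point i previous next)
  ... | inj₂ previous′ = previous′

  FreeEndOnPrevious-+ : ∀ t i → FreeEndOnPrevious i → FreeEndOnPrevious (t + i)
  FreeEndOnPrevious-+ zero    i previous = previous
  FreeEndOnPrevious-+ (suc t) i previous = FreeEndOnPrevious-suc (t + i) (FreeEndOnPrevious-+ t i previous)

  -- Parallel neighbours meet at both free ends; carrying the second contact once round the
  -- cycle puts the free end of Sᵢ on its other neighbour too.
  consecutive-perpendicular : ∀ i → orient (S i) ≢ orient (S (suc i))
  consecutive-perpendicular i parallel with consecutive-contact i
  ... | disjoint , p , p∈Sᵢ , p∈Sᵢ₊₁ , _
    with parallel-contact⇒endpoints (S i) (S (suc i)) parallel disjoint p∈Sᵢ p∈Sᵢ₊₁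
  ... | endᵢ , endᵢ₊₁ = two-apart-share-no-point (3 + r + i) previous next
    where
    previous : FreeEndOnPrevious (3 + r + i)
    previous = FreeEndOnPrevious-+ (3 + r) i
      (subst (_∈Seg S i) (free-end-unique (at-suc-≢ i) endᵢ₊₁ p∈Sᵢ) p∈Sᵢ)
    at-suc-periodic : at (suc (k + i)) ≡ at (suc i)
    at-suc-periodic = trans (cong at (sym (ℕP.+-suc k i))) (at-periodic (suc i))
    next : free (k + i) ∈Seg S (suc (k + i))
    next = subst₂ (λ x y → free-end x ∈Seg σ (cyc y)) (sym (at-periodic i)) (sym at-suc-periodic)
      (subst (_∈Seg S (suc i)) (free-end-unique (≢-sym (at-suc-≢ i)) endᵢ p∈Sᵢ₊₁) p∈Sᵢ₊₁)

  even-orientation : ∀ t → orient (S (t * 2)) ≡ orient (S 0)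
  even-orientation zero    = refl
  even-orientation (suc t) =
    trans (sym (two-orientations (consecutive-perpendicular (t * 2))
                                 (consecutive-perpendicular (suc (t * 2)))))
          (even-orientation t)

  ¬odd : ∀ m → k ≡ suc (2 * m) → ⊥
  ¬odd m k≡1+2m =
    consecutive-perpendicular (m * 2) (trans (even-orientation m) (cong (orient ∘ σ ∘ cyc) wrap))
    where
    k≡1+m*2 : k + 0 ≡ suc (m * 2)
    k≡1+m*2 = trans (ℕP.+-identityʳ k) (trans k≡1+2m (cong suc (ℕP.*-comm 2 m)))
    wrap : at 0 ≡ at (suc (m * 2))
    wrap = trans (sym (at-periodic 0)) (cong at k≡1+m*2)

lemma14 : (k : ℕ) → 5 ≤ k → ∃ (λ m → k ≡ suc (2 * m)) →
    ¬ ContactB0VPG (F3Vertex k) (F3Adj k)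
lemma14 _ (s≤s (s≤s (s≤s (s≤s (s≤s (z≤n {r})))))) (m , odd) (σ , disjoint , adjacency) =
  Representation.¬odd (suc r) σ disjoint adjacency m odd
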